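{- Let $(\Omega,S)$ be a regular thin Jordan scheme, fix $\omega_0\in\Omega$, let $\diamond$ and $\ell_a$ be as in the context, and for $u,v\in S$ let $A_{u,v}=\{w\in S: u\diamond(v\diamond w)=(u\diamond v)\diamond w\}$. Let $u,v\in S$. Then: (a) if $u\diamond v=v\diamond u$, then $\ell_u\circ\ell_v=\ell_v\circ\ell_u=\ell_{u\diamond v}$ and $A_{u,v}=S$; (b) if $u\diamond v\neq v\diamond u$, then the permutations $\ell_u\circ\ell_v$ and $\ell_v\circ\ell_u$ are disjoint as relations, i.e. $\ell_u(\ell_v(x))\neq\ell_v(\ell_u(x))$ for every $x\in S$.
   Context: $\Omega$ is a finite nonempty set, $\mathbb{F}$ a field with $\mathrm{char}\,\mathbb{F}\neq2$, $A\star B=\tfrac12(AB+BA)$. A regular thin Jordan scheme $(\Omega,S)$ here means: $S$ is a set of permutations of $\Omega$, each regarded as the relation $\{(\omega,s(\omega))\}$, such that these relations partition $\Omega\times\Omega$, $1_\Omega\in S$, $s^{ -1}\in S$ for every $s\in S$, and the $\mathbb{F}$-span of the permutation matrices of the elements of $S$ is closed under $\star$. For fixed $\omega_0\in\Omega$ and $a,b\in S$, $a\diamond b$ is the unique $c\in S$ with $c(\omega_0)=a(b(\omega_0))$; $\ell_a:S\to S$ is $\ell_a(x)=a\diamond x$. -}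

module Defs where

open import Level using (_⊔_; suc)
open import Data.Nat.Base using (ℕ)
open import Data.Fin.Base using (Fin)
open import Data.Fin.Properties using (_≟_)
open import Data.Fin.Permutation using (Permutation′; _⟨$⟩ʳ_; _⟨$⟩ˡ_)
open import Data.Product using (Σ; ∃; ∃!; _×_; proj₁)
open import Data.Bool.Base using (if_then_else_)
open import Relation.Nullary using (¬_)
open import Relation.Nullary.Decidable using (⌊_⌋)
open import Relation.Binary.PropositionalEquality using (_≡_)
open import Algebra.Bundles using (CommutativeRing)
import Algebra.Properties.Monoid.Sum as MonoidSum

record Field c ℓ : Set (Level.suc (c ⊔ ℓ)) where
  field
    commutativeRing : CommutativeRing c ℓ
  open CommutativeRing commutativeRing public
  field
    1≉0 : ¬ (1# ≈ 0#)
    inverse : ∀ x → ¬ (x ≈ 0#) → Σ Carrier (λ y → x * y ≈ 1#)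

CharNot2 : ∀ {c ℓ} → Field c ℓ → Set ℓ
CharNot2 F = ¬ (1# + 1# ≈ 0#) where open Field F

module _ {c ℓ} (F : Field c ℓ) (char≠2 : CharNot2 F) where
  open Field F
  open MonoidSum +-monoid using (sum)

  Matrix : ℕ → Set c
  Matrix n = Fin n → Fin n → Carrier

  _≈ᴹ_ : ∀ {n} → Matrix n → Matrix n → Set ℓ
  A ≈ᴹ B = ∀ i j → A i j ≈ B i j

  _+ᴹ_ : ∀ {n} → Matrix n → Matrix n → Matrix n
  (A +ᴹ B) i j = A i j + B i j

  _·ᴹ_ : ∀ {n} → Matrix n → Matrix n → Matrix n
  (A ·ᴹ B) i j = sum (λ k → A i k * B k j)

  _∙ᴹ_ : ∀ {n} → Carrier → Matrix n → Matrix n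
  (a ∙ᴹ A) i j = a * A i j

  two : Carrier
  two = 1# + 1#

  half : Carrier
  half = proj₁ (inverse two char≠2)

  _⋆_ : ∀ {n} → Matrix n → Matrix n → Matrix n
  A ⋆ B = half ∙ᴹ ((A ·ᴹ B) +ᴹ (B ·ᴹ A))

  -- permutation matrix of s: entry (ω, ω') is 1 iff ω' = s(ω),
  -- i.e. the adjacency matrix of the relation {(ω, s ω)}
  permMatrix : ∀ {n} → Permutation′ n → Matrix n
  permMatrix s i j = if ⌊ s ⟨$⟩ʳ i ≟ j ⌋ then 1# else 0#

  -- S is given as an indexed
  -- family of permutations s : Fin m → Permutation′ n (the elements of S
  -- are the indices; by the partition condition distinct indices give
  -- distinct permutations when Ω is nonempty).
  record RegularThinJordanScheme (n : ℕ) : Set (c ⊔ ℓ) where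
    field
      m : ℕ
      s : Fin m → Permutation′ n
      partition : ∀ ω ω′ → ∃! _≡_ (λ i → s i ⟨$⟩ʳ ω ≡ ω′)
      hasIdentity : ∃ λ i → ∀ ω → s i ⟨$⟩ʳ ω ≡ ω
      hasInverses : ∀ i → ∃ λ j → ∀ ω → s j ⟨$⟩ʳ ω ≡ s i ⟨$⟩ˡ ω

    InSpan : Matrix n → Set (c ⊔ ℓ)
    InSpan A = Σ (Fin m → Carrier) λ coeff →
                 A ≈ᴹ (λ i j → sum (λ k → coeff k * permMatrix (s k) i j))

    field
      jordanClosed : ∀ A B → InSpan A → InSpan B → InSpan (A ⋆ B)

    module _ (ω₀ : Fin n) where
      _⋄_ : Fin m → Fin m → Fin m
      a ⋄ b = proj₁ (partition ω₀ (s a ⟨$⟩ʳ (s b ⟨$⟩ʳ ω₀)))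

      ℓ[_] : Fin m → Fin m → Fin m
      ℓ[ a ] x = a ⋄ x

      InA : Fin m → Fin m → Fin m → Set
      InA u v w = u ⋄ (v ⋄ w) ≡ (u ⋄ v) ⋄ w

-- The anticommutator P_u P_v + P_v P_u = 2 (P_u ⋆ P_v) lies in the span of the
-- permutation matrices, and since the relations of S partition Ω × Ω, every matrix
-- in that span is constant on each relation. Its (y, z) entry counts which of
-- v (u y) = z and u (v y) = z hold, so (as 2 differs from 0 and 1) it equals 2
-- exactly where v ∘ u and u ∘ v agree. Hence if v ∘ u and u ∘ v agree at a single
-- point y, both coincide everywhere with the element of S relating y to u (v y).
-- Through the injection a ↦ a ω₀ from S to Ω, agreement at ω₀ is u ⋄ v = v ⋄ u,
-- which gives (a); and ℓ_u ℓ_v x = ℓ_v ℓ_u x is agreement at x ω₀, which forces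
-- agreement at ω₀, giving (b).

module Submission where

open import Defs
open import Data.Nat.Base using (ℕ; suc)
open import Data.Fin.Base using (Fin; punchIn)
open import Data.Fin.Properties using (_≟_; punchInᵢ≢i)
open import Data.Fin.Permutation using (Permutation′; _⟨$⟩ʳ_)
open import Data.Vec.Functional using (Vector)
open import Data.Product using (_×_; _,_; proj₁; proj₂)
open import Data.Bool.Base using (if_then_else_)
open import Function using (_∘_)
open import Relation.Nullary using (¬_; yes; no; contradiction)
open import Relation.Nullary.Decidable using (⌊_⌋)
open import Relation.Binary.PropositionalEquality as ≡ using (_≡_; _≢_)
open import Algebra.Bundles using (CommutativeMonoid)
import Algebra.Properties.CommutativeMonoid.Sum as CommutativeMonoidSum
import Algebra.Properties.Monoid as MonoidProperties
import Algebra.Properties.Group as GroupProperties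
import Relation.Binary.Reasoning.Setoid as SetoidReasoning

module _ {c ℓ} (M : CommutativeMonoid c ℓ) where
  open CommutativeMonoid M
  open CommutativeMonoidSum M using (sum; sum-cong-≋; sum-replicate-zero; sum-remove)
  open SetoidReasoning setoid

  sum-zero : ∀ {k} (f : Vector Carrier k) → (∀ i → f i ≈ ε) → sum f ≈ ε
  sum-zero {k} f f≈ε = trans (sum-cong-≋ f≈ε) (sum-replicate-zero k)

  sum-single : ∀ {k} (f : Vector Carrier k) i → (∀ j → j ≢ i → f j ≈ ε) → sum f ≈ f i
  sum-single {suc k} f i f≈ε = begin
    sum f                      ≈⟨ sum-remove f ⟩
    f i ∙ sum (f ∘ punchIn i)  ≈⟨ ∙-congˡ (sum-zero _ (λ j → f≈ε _ (punchInᵢ≢i i j))) ⟩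
    f i ∙ ε                    ≈⟨ identityʳ (f i) ⟩
    f i                        ∎

module _ {c ℓ} (F : Field c ℓ) (char≠2 : CharNot2 F) where
  open Field F
  open SetoidReasoning setoid

  half-cancel : ∀ {x y} → half F char≠2 * x ≈ half F char≠2 * y → x ≈ y
  half-cancel {x} {y} eq = begin
    x                                   ≈⟨ cancelˡ two*half≈1 x ⟨
    two F char≠2 * (half F char≠2 * x)  ≈⟨ *-congˡ eq ⟩
    two F char≠2 * (half F char≠2 * y)  ≈⟨ cancelˡ two*half≈1 y ⟩
    y                                   ∎
    where
    open MonoidProperties *-monoid using (cancelˡ)
    two*half≈1 : two F char≠2 * half F char≠2 ≈ 1#
    two*half≈1 = proj₂ (inverse (two F char≠2) char≠2)

module PermutationMatrix {c ℓ} (F : Field c ℓ) (char≠2 : CharNot2 F) {n : ℕ} where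
  open Field F
  open GroupProperties +-group using (∙-cancelˡ; ∙-cancelʳ)

  P : Permutation′ n → Matrix F char≠2 n
  P = permMatrix F char≠2

  _·_ : Matrix F char≠2 n → Matrix F char≠2 n → Matrix F char≠2 n
  _·_ = _·ᴹ_ F char≠2

  P-≡ : ∀ t {i j} → t ⟨$⟩ʳ i ≡ j → P t i j ≈ 1#
  P-≡ t {i} {j} ti≡j with t ⟨$⟩ʳ i ≟ j
  ... | yes _   = refl
  ... | no ti≢j = contradiction ti≡j ti≢j

  P-≢ : ∀ t {i j} → t ⟨$⟩ʳ i ≢ j → P t i j ≈ 0#
  P-≢ t {i} {j} ti≢j with t ⟨$⟩ʳ i ≟ j
  ... | yes ti≡j = contradiction ti≡j ti≢j
  ... | no _     = refl

  P-·-P : ∀ a b i j → (P a · P b) i j ≈ P b (a ⟨$⟩ʳ i) j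
  P-·-P a b i j = trans (sum-single +-commutativeMonoid _ (a ⟨$⟩ʳ i) vanishes)
                        (trans (*-congʳ (P-≡ a ≡.refl)) (*-identityˡ _))
    where
    vanishes : ∀ k → k ≢ a ⟨$⟩ʳ i → P a i k * P b k j ≈ 0#
    vanishes k k≢ai = trans (*-congʳ (P-≢ a (k≢ai ∘ ≡.sym))) (zeroˡ _)

  P+P≈two : ∀ a b {i i′ j} → a ⟨$⟩ʳ i ≡ j → b ⟨$⟩ʳ i′ ≡ j → P a i j + P b i′ j ≈ two F char≠2
  P+P≈two a b ai≡j bi≡j = +-cong (P-≡ a ai≡j) (P-≡ b bi≡j)

  -- Each summand is 0 or 1, and 0 + 0, 0 + 1, 1 + 0 differ from 2 since 1 ≉ 0 and 2 ≉ 0.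
  P+P≈two⁻¹ : ∀ a b {i i′ j} → P a i j + P b i′ j ≈ two F char≠2 → a ⟨$⟩ʳ i ≡ j × b ⟨$⟩ʳ i′ ≡ j
  P+P≈two⁻¹ a b {i} {i′} {j} eq with a ⟨$⟩ʳ i ≟ j | b ⟨$⟩ʳ i′ ≟ j
  ... | yes ai≡j | yes bi≡j = ai≡j , bi≡j
  ... | yes _    | no _     = contradiction (∙-cancelˡ 1# 1# 0# (sym eq)) 1≉0
  ... | no _     | yes _    = contradiction (∙-cancelʳ 1# 1# 0# (sym eq)) 1≉0
  ... | no _     | no _     = contradiction (trans (sym eq) (+-identityˡ 0#)) char≠2

module ThinScheme {c ℓ} {F : Field c ℓ} {char≠2 : CharNot2 F} {n : ℕ}
                  (X : RegularThinJordanScheme F char≠2 n) where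
  open Field F
  open RegularThinJordanScheme X
  open PermutationMatrix F char≠2
  open SetoidReasoning setoid

  rel : Fin n → Fin n → Fin m
  rel ω ω′ = proj₁ (partition ω ω′)

  rel-sound : ∀ ω ω′ → s (rel ω ω′) ⟨$⟩ʳ ω ≡ ω′
  rel-sound ω ω′ = proj₁ (proj₂ (partition ω ω′))

  rel-unique : ∀ {ω ω′ k} → s k ⟨$⟩ʳ ω ≡ ω′ → rel ω ω′ ≡ k
  rel-unique {ω} {ω′} = proj₂ (proj₂ (partition ω ω′))

  δ : Fin m → Fin m → Carrier
  δ k j = if ⌊ j ≟ k ⌋ then 1# else 0#

  P-inSpan : ∀ k → InSpan (P (s k))
  P-inSpan k = δ k , λ i j → sym (expansion i j)
    where
    open CommutativeMonoidSum +-commutativeMonoid using (sum)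

    δ-diagonal : δ k k ≈ 1#
    δ-diagonal with k ≟ k
    ... | yes _   = refl
    ... | no k≢k = contradiction ≡.refl k≢k

    expansion : ∀ i j → sum (λ l → δ k l * P (s l) i j) ≈ P (s k) i j
    expansion i j = begin
      sum (λ l → δ k l * P (s l) i j)  ≈⟨ sum-single +-commutativeMonoid _ k vanishes ⟩
      δ k k * P (s k) i j              ≈⟨ *-congʳ δ-diagonal ⟩
      1# * P (s k) i j                 ≈⟨ *-identityˡ _ ⟩
      P (s k) i j                      ∎
      where
      vanishes : ∀ l → l ≢ k → δ k l * P (s l) i j ≈ 0#
      vanishes l l≢k with l ≟ k
      ... | yes l≡k = contradiction l≡k l≢k
      ... | no _    = zeroˡ _

  inSpan-entry : ∀ {A} ((coeff , _) : InSpan A) i j → A i j ≈ coeff (rel i j)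
  inSpan-entry {A} (coeff , A≈) i j = begin
    A i j                                  ≈⟨ A≈ i j ⟩
    sum (λ k → coeff k * P (s k) i j)      ≈⟨ sum-single +-commutativeMonoid _ (rel i j) vanishes ⟩
    coeff (rel i j) * P (s (rel i j)) i j  ≈⟨ *-congˡ (P-≡ (s (rel i j)) (rel-sound i j)) ⟩
    coeff (rel i j) * 1#                   ≈⟨ *-identityʳ _ ⟩
    coeff (rel i j)                        ∎
    where
    open CommutativeMonoidSum +-commutativeMonoid using (sum)
    vanishes : ∀ k → k ≢ rel i j → coeff k * P (s k) i j ≈ 0#
    vanishes k k≢rel = trans (*-congˡ (P-≢ (s k) (k≢rel ∘ ≡.sym ∘ rel-unique))) (zeroʳ _)

  inSpan-constant : ∀ {A} → InSpan A → ∀ y z y′ → A y z ≈ A y′ (s (rel y z) ⟨$⟩ʳ y′)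
  inSpan-constant {A} A∈span@(coeff , _) y z y′ = begin
    A y z              ≈⟨ inSpan-entry A∈span y z ⟩
    coeff (rel y z)    ≡⟨ ≡.cong coeff (rel-unique ≡.refl) ⟨
    coeff (rel y′ z′)  ≈⟨ inSpan-entry A∈span y′ z′ ⟨
    A y′ z′            ∎
    where
    z′ : Fin n
    z′ = s (rel y z) ⟨$⟩ʳ y′

  anticommutator : Fin m → Fin m → Matrix F char≠2 n
  anticommutator u v = _+ᴹ_ F char≠2 (P (s u) · P (s v)) (P (s v) · P (s u))

  anticommutator-entry : ∀ u v i j →
    anticommutator u v i j ≈ P (s v) (s u ⟨$⟩ʳ i) j + P (s u) (s v ⟨$⟩ʳ i) j
  anticommutator-entry u v i j = +-cong (P-·-P (s u) (s v) i j) (P-·-P (s v) (s u) i j)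

  -- P (s u) ⋆ P (s v) is half the anticommutator, and lies in the span by Jordan closure.
  anticommutator-constant : ∀ u v y z y′ →
    anticommutator u v y z ≈ anticommutator u v y′ (s (rel y z) ⟨$⟩ʳ y′)
  anticommutator-constant u v y z y′ = half-cancel F char≠2
    (inSpan-constant (jordanClosed (P (s u)) (P (s v)) (P-inSpan u) (P-inSpan v)) y z y′)

  -- If v ∘ u and u ∘ v agree at one point y, the anticommutator has entry 2 at
  -- (y, u (v y)), hence along the whole relation through that pair.
  commute-at⇒composites-agree : ∀ u v {y} →
    s v ⟨$⟩ʳ (s u ⟨$⟩ʳ y) ≡ s u ⟨$⟩ʳ (s v ⟨$⟩ʳ y) →
    let k = rel y (s u ⟨$⟩ʳ (s v ⟨$⟩ʳ y)) in
    ∀ y′ → s v ⟨$⟩ʳ (s u ⟨$⟩ʳ y′) ≡ s k ⟨$⟩ʳ y′ × s u ⟨$⟩ʳ (s v ⟨$⟩ʳ y′) ≡ s k ⟨$⟩ʳ y′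
  commute-at⇒composites-agree u v {y} vu≡uv y′ = P+P≈two⁻¹ (s v) (s u) (begin
    P (s v) (s u ⟨$⟩ʳ y′) z′ + P (s u) (s v ⟨$⟩ʳ y′) z′  ≈⟨ anticommutator-entry u v y′ z′ ⟨
    anticommutator u v y′ z′                             ≈⟨ anticommutator-constant u v y z y′ ⟨
    anticommutator u v y z                               ≈⟨ anticommutator-entry u v y z ⟩
    P (s v) (s u ⟨$⟩ʳ y) z + P (s u) (s v ⟨$⟩ʳ y) z      ≈⟨ P+P≈two (s v) (s u) vu≡uv ≡.refl ⟩
    two F char≠2                                         ∎)
    where
    z z′ : Fin n
    z = s u ⟨$⟩ʳ (s v ⟨$⟩ʳ y)
    z′ = s (rel y z) ⟨$⟩ʳ y′

module ThinSchemePoints {c ℓ} {F : Field c ℓ} {char≠2 : CharNot2 F} {n : ℕ}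
                        (X : RegularThinJordanScheme F char≠2 n) (ω₀ : Fin n) where
  open RegularThinJordanScheme X
  open ThinScheme X
  open ≡.≡-Reasoning

  _⋄₀_ : Fin m → Fin m → Fin m
  _⋄₀_ = _⋄_ ω₀

  point : Fin m → Fin n
  point a = s a ⟨$⟩ʳ ω₀

  point-injective : ∀ {a b} → point a ≡ point b → a ≡ b
  point-injective a≡b = ≡.trans (≡.sym (rel-unique {ω₀} ≡.refl)) (rel-unique (≡.sym a≡b))

  point-⋄ : ∀ a b → point (a ⋄₀ b) ≡ s a ⟨$⟩ʳ point b
  point-⋄ a b = rel-sound ω₀ _

  point-⋄⋄ : ∀ a b x → point (a ⋄₀ (b ⋄₀ x)) ≡ s a ⟨$⟩ʳ (s b ⟨$⟩ʳ point x)
  point-⋄⋄ a b x = ≡.trans (point-⋄ a _) (≡.cong (s a ⟨$⟩ʳ_) (point-⋄ b x))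

  ⋄⋄≡⋄ : ∀ a b c x → s a ⟨$⟩ʳ (s b ⟨$⟩ʳ point x) ≡ s c ⟨$⟩ʳ point x → a ⋄₀ (b ⋄₀ x) ≡ c ⋄₀ x
  ⋄⋄≡⋄ a b c x ab≡c = point-injective (begin
    point (a ⋄₀ (b ⋄₀ x))        ≡⟨ point-⋄⋄ a b x ⟩
    s a ⟨$⟩ʳ (s b ⟨$⟩ʳ point x)  ≡⟨ ab≡c ⟩
    s c ⟨$⟩ʳ point x             ≡⟨ point-⋄ c x ⟨
    point (c ⋄₀ x)               ∎)

  ⋄-comm⇒composites≡ : ∀ {u v} → u ⋄₀ v ≡ v ⋄₀ u → ∀ y →
    s v ⟨$⟩ʳ (s u ⟨$⟩ʳ y) ≡ s (u ⋄₀ v) ⟨$⟩ʳ y × s u ⟨$⟩ʳ (s v ⟨$⟩ʳ y) ≡ s (u ⋄₀ v) ⟨$⟩ʳ y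
  ⋄-comm⇒composites≡ {u} {v} uv≡vu = commute-at⇒composites-agree u v (begin
    s v ⟨$⟩ʳ point u  ≡⟨ point-⋄ v u ⟨
    point (v ⋄₀ u)    ≡⟨ ≡.cong point uv≡vu ⟨
    point (u ⋄₀ v)    ≡⟨ point-⋄ u v ⟩
    s u ⟨$⟩ʳ point v  ∎)

  ⋄-comm⇒⋄-assocʳ : ∀ {u v} → u ⋄₀ v ≡ v ⋄₀ u → ∀ x → u ⋄₀ (v ⋄₀ x) ≡ (u ⋄₀ v) ⋄₀ x
  ⋄-comm⇒⋄-assocʳ {u} {v} uv≡vu x =
    ⋄⋄≡⋄ u v (u ⋄₀ v) x (proj₂ (⋄-comm⇒composites≡ uv≡vu (point x)))

  ⋄-comm⇒⋄-assocˡ : ∀ {u v} → u ⋄₀ v ≡ v ⋄₀ u → ∀ x → v ⋄₀ (u ⋄₀ x) ≡ (u ⋄₀ v) ⋄₀ x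
  ⋄-comm⇒⋄-assocˡ {u} {v} uv≡vu x =
    ⋄⋄≡⋄ v u (u ⋄₀ v) x (proj₁ (⋄-comm⇒composites≡ uv≡vu (point x)))

  ⋄⋄-comm⇒⋄-comm : ∀ {u v} x → u ⋄₀ (v ⋄₀ x) ≡ v ⋄₀ (u ⋄₀ x) → u ⋄₀ v ≡ v ⋄₀ u
  ⋄⋄-comm⇒⋄-comm {u} {v} x uvx≡vux =
    let vu≡k , uv≡k = commute-at⇒composites-agree u v vu≡uv ω₀
    in ≡.cong (rel ω₀) (≡.trans uv≡k (≡.sym vu≡k))
    where
    vu≡uv : s v ⟨$⟩ʳ (s u ⟨$⟩ʳ point x) ≡ s u ⟨$⟩ʳ (s v ⟨$⟩ʳ point x)
    vu≡uv = begin
      s v ⟨$⟩ʳ (s u ⟨$⟩ʳ point x)  ≡⟨ point-⋄⋄ v u x ⟨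
      point (v ⋄₀ (u ⋄₀ x))        ≡⟨ ≡.cong point uvx≡vux ⟨
      point (u ⋄₀ (v ⋄₀ x))        ≡⟨ point-⋄⋄ u v x ⟩
      s u ⟨$⟩ʳ (s v ⟨$⟩ʳ point x)  ∎

proposition3p9 : ∀ {c ℓ} (F : Field c ℓ) (char≠2 : CharNot2 F) (n : ℕ)
    (X : RegularThinJordanScheme F char≠2 n) (ω₀ : Fin n)
    (u v : Fin (RegularThinJordanScheme.m X)) →
    let open RegularThinJordanScheme X in
    ((_⋄_ ω₀ u v ≡ _⋄_ ω₀ v u) →
      (∀ x → ℓ[_] ω₀ u (ℓ[_] ω₀ v x) ≡ ℓ[_] ω₀ v (ℓ[_] ω₀ u x))
      × (∀ x → ℓ[_] ω₀ v (ℓ[_] ω₀ u x) ≡ ℓ[_] ω₀ (_⋄_ ω₀ u v) x)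
      × (∀ w → InA ω₀ u v w))
    × (¬ (_⋄_ ω₀ u v ≡ _⋄_ ω₀ v u) →
      ∀ x → ¬ (ℓ[_] ω₀ u (ℓ[_] ω₀ v x) ≡ ℓ[_] ω₀ v (ℓ[_] ω₀ u x)))
proposition3p9 F char≠2 n X ω₀ u v =
  (λ uv≡vu → (λ x → ≡.trans (⋄-comm⇒⋄-assocʳ uv≡vu x) (≡.sym (⋄-comm⇒⋄-assocˡ uv≡vu x)))
           , ⋄-comm⇒⋄-assocˡ uv≡vu
           , ⋄-comm⇒⋄-assocʳ uv≡vu)
  , (λ uv≢vu x → uv≢vu ∘ ⋄⋄-comm⇒⋄-comm x)
  where open ThinSchemePoints X ω₀
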